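{- Let $F$ be a 2-CNF formula and $w$ a walk of $F$ with first literal $l_x$ and last literal $l_y$. Then $SWRT(F,\{\neg l_x,\neg l_y\})$ is false. In particular, if $l_x=l_y$ then $SWRT(F,\{\neg l_x\})$ is false.
   Context: A literal is a Boolean variable or its negation; $\neg$ denotes negation, and for a set $L$ of literals $\neg L=\{\neg l': l'\in L\}$. $Var(\cdot)$ denotes the set of variables of a literal, set of literals or formula. A 2-CNF formula $F$ is a conjunction of clauses each consisting of exactly two literals (a one-literal clause $(l)$ is written $(l\vee l)$; $(l_1\vee l_2)$ and $(l_2\vee l_1)$ are the same clause), with pairwise distinct clauses. A set of literals is non-contradictory if it contains no literal and its negation. A satisfying assignment of $F$ is a non-contradictory set $P$ of literals with $Var(P)=Var(F)$ such that each clause of $F$ contains a literal of $P$. $SWRT(F,L)$ means $F$ has a satisfying assignment $P$ with $P\cap \neg L=\emptyset$. A walk of $F$ is a nonempty sequence $(C_1,\dots,C_q)$ of (not necessarily distinct) clauses of $F$ where in each entry one literal is designated the first literal and the other the second literal, such that for every $i<q$ the second literal of $C_i$ is the negation of the first literal of $C_{i+1}$. The first literal of the walk is the first literal of $C_1$; its last literal is the second literal of $C_q$. -}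

module Defs where

open import Data.Nat using (ℕ)
open import Data.Bool using (Bool; not)
open import Data.Product using (_×_; _,_; Σ; ∃)
open import Data.Sum using (_⊎_)
open import Data.List using (List; []; _∷_; map)
open import Data.List.Membership.Propositional using (_∈_)
open import Data.List.Relation.Unary.AllPairs using (AllPairs)
open import Relation.Binary.PropositionalEquality using (_≡_)
open import Relation.Nullary using (¬_)

record Lit : Set where
  constructor lit
  field
    var : ℕ
    pos : Bool
open Lit public

neg : Lit → Lit
neg (lit v b) = lit v (not b)

negs : List Lit → List Lit
negs L = map neg L

-- A clause (l₁ ∨ l₂); a one-literal clause (l) is (l ∨ l).
Clause : Set
Clause = Lit × Lit

SameClause : Clause → Clause → Set
SameClause (a , b) (c , d) = (a ≡ c × b ≡ d) ⊎ (a ≡ d × b ≡ c)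

record TwoCNF : Set where
  constructor mk2CNF
  field
    clauses  : List Clause
    distinct : AllPairs (λ c d → ¬ SameClause c d) clauses
open TwoCNF public

VarF : TwoCNF → ℕ → Set
VarF F v = Σ Clause λ c → c ∈ clauses F ×
  (var (Data.Product.proj₁ c) ≡ v ⊎ var (Data.Product.proj₂ c) ≡ v)

VarL : List Lit → ℕ → Set
VarL P v = Σ Lit λ l → l ∈ P × var l ≡ v

NonContradictory : List Lit → Set
NonContradictory P = ∀ l → l ∈ P → ¬ (neg l ∈ P)

SatAssign : TwoCNF → List Lit → Set
SatAssign F P =
  NonContradictory P ×
  (∀ v → (VarL P v → VarF F v) × (VarF F v → VarL P v)) ×
  (∀ a b → (a , b) ∈ clauses F → a ∈ P ⊎ b ∈ P)

SWRT : TwoCNF → List Lit → Set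
SWRT F L = ∃ λ P → SatAssign F P × (∀ l → l ∈ P → ¬ (l ∈ negs L))

OrientedClause : TwoCNF → Lit → Lit → Set
OrientedClause F a b = (a , b) ∈ clauses F ⊎ (b , a) ∈ clauses F

data Walk (F : TwoCNF) : Lit → Lit → Set where
  single : ∀ {a b} → OrientedClause F a b → Walk F a b
  step   : ∀ {a c b} → OrientedClause F a c → Walk F (neg c) b → Walk F a b

module Submission where

-- A clause (a ∨ b) read in the orientation a ↦ b is the implication
-- ¬a ⇒ b, and a walk chains such implications: leaving the clause through its
-- second literal b forces ¬(neg b) for the next clause, because a
-- non-contradictory assignment containing b cannot contain neg b.  Hence
-- every satisfying assignment that omits the first literal of a walk must
-- contain its last literal (walk-propagates).
--
-- A satisfying assignment P witnessing SWRT(F, L) avoids ¬L, so it omits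
-- every literal whose negation lies in L (avoids-negated-members).  If both
-- ¬lx and ¬ly lie in L, such a P omits lx, hence contains ly by the walk
-- property, and also omits ly: a contradiction (walk-forbids-SWRT).

open import Defs
open import Data.Bool.Properties using (not-involutive)
open import Data.List using (List; []; _∷_)
open import Data.List.Membership.Propositional using (_∈_)
open import Data.List.Membership.Propositional.Properties using (∈-map⁺)
open import Data.List.Relation.Unary.Any using (here; there)
open import Data.Product using (_×_; _,_)
open import Data.Sum using (_⊎_; inj₁; inj₂)
open import Relation.Binary.PropositionalEquality using (_≡_; refl; cong; subst)
open import Relation.Nullary using (¬_; contradiction)

neg-involutive : ∀ l → neg (neg l) ≡ l
neg-involutive (lit v b) = cong (lit v) (not-involutive b)

SatisfiesClauses : TwoCNF → List Lit → Set
SatisfiesClauses F P = ∀ a b → (a , b) ∈ clauses F → a ∈ P ⊎ b ∈ P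

oriented-clause-propagates : ∀ {F P a b} → SatisfiesClauses F P →
  OrientedClause F a b → ¬ a ∈ P → b ∈ P
oriented-clause-propagates sat (inj₁ ab∈F) a∉P with sat _ _ ab∈F
... | inj₁ a∈P = contradiction a∈P a∉P
... | inj₂ b∈P = b∈P
oriented-clause-propagates sat (inj₂ ba∈F) a∉P with sat _ _ ba∈F
... | inj₁ b∈P = b∈P
... | inj₂ a∈P = contradiction a∈P a∉P

walk-propagates : ∀ {F P a b} → NonContradictory P → SatisfiesClauses F P →
  Walk F a b → ¬ a ∈ P → b ∈ P
walk-propagates {F} nc sat (single o) a∉P =
  oriented-clause-propagates {F} sat o a∉P
walk-propagates {F} nc sat (step {c = c} o w) a∉P =
  walk-propagates nc sat w (nc c (oriented-clause-propagates {F} sat o a∉P))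

avoids-negated-members : ∀ {P L l} → (∀ l' → l' ∈ P → ¬ l' ∈ negs L) →
  neg l ∈ L → ¬ l ∈ P
avoids-negated-members {l = l} avoid negl∈L l∈P =
  avoid l l∈P (subst (_∈ negs _) (neg-involutive l) (∈-map⁺ neg negl∈L))

walk-forbids-SWRT : ∀ {F L lx ly} → Walk F lx ly →
  neg lx ∈ L → neg ly ∈ L → ¬ SWRT F L
walk-forbids-SWRT w neglx∈L negly∈L (P , (nc , _ , sat) , avoid) =
  avoids-negated-members avoid negly∈L
    (walk-propagates nc sat w (avoids-negated-members avoid neglx∈L))

lemma1 : (F : TwoCNF) (lx ly : Lit) → Walk F lx ly →
    ¬ SWRT F (neg lx ∷ neg ly ∷ []) × (lx ≡ ly → ¬ SWRT F (neg lx ∷ []))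
lemma1 F lx ly w = walk-forbids-SWRT w (here refl) (there (here refl))
                 , λ { refl → walk-forbids-SWRT w (here refl) (here refl) }
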